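{- Let $R$ be the graph with vertex set $\{a,b,c,d\}$ and all edges except $ac$ (i.e., $K_4$ minus the edge $ac$). Let $\mathcal{H}=(L,H)$ be a correspondence cover of $R$ in which every matching $M_{e}$, $e\in E(R)$, is maximal, with $|L(a)|=|L(c)|=1$ and $|L(b)|=|L(d)|=2$. If $\mathcal{H}$ is not twisted, then there exists a $1$-defective $\mathcal{H}$-coloring $\phi$ of $R$. Furthermore, if $\mathcal{H}$ is not wedged, then $\phi$ may be chosen with $\mathrm{def}_\phi(a)=0$.
   Context: A correspondence cover of a graph $G$ is a pair $\mathcal{H}=(L,H)$ with $H$ a graph and $L:V(G)\to 2^{V(H)}$ such that $\{L(v)\}$ partitions $V(H)$, each $L(v)$ is independent in $H$, and for all $u,v$ the edges of $H$ between $L(u)$ and $L(v)$ form a matching $M_{uv}$, empty if $uv\notin E(G)$. An $\mathcal{H}$-coloring is a map $\phi$ with $\phi(w)\in L(w)$; $\mathrm{def}_\phi(w)$ is the number of neighbors $w'$ of $w$ with $\phi(w')\phi(w)\in E(H)$; $\phi$ is $1$-defective if $\mathrm{def}_\phi(w)\le 1$ for all $w$. For a cover of $R$ with $|L(a)|=|L(c)|=1$, $|L(b)|=|L(d)|=2$: $\mathcal{H}$ is twisted if the colors can be labeled $L(a)=\{a_1\}$, $L(b)=\{b_1,b_2\}$, $L(c)=\{c_1\}$, $L(d)=\{d_1,d_2\}$ so that $a_1b_1d_2c_1b_2d_1a_1$ is a cycle in $H$; $\mathcal{H}$ is wedged if the colors can be so labeled that $a_1b_1$ and $a_1d_1$ are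 edges of $H$ and at least two of $b_2d_2$, $c_1b_2$, $c_1d_2$ are edges of $H$. -}

module Defs where

open import Data.Nat using (ℕ; zero; suc; _+_; _≤_)
open import Data.Fin using (Fin; zero; suc)
open import Data.Bool using (Bool; true; false; _∧_)
open import Data.Product using (Σ; _×_; _,_)
open import Data.Sum using (_⊎_)
open import Relation.Binary.PropositionalEquality using (_≡_)

data V : Set where
  a b c d : V

adjR : V → V → Bool
adjR a a = false
adjR a b = true
adjR a c = false
adjR a d = true
adjR b a = true
adjR b b = false
adjR b c = true
adjR b d = true
adjR c a = false
adjR c b = true
adjR c c = false
adjR c d = true
adjR d a = true
adjR d b = true
adjR d c = true
adjR d d = false

sz : V → ℕ
sz a = 1
sz b = 2
sz c = 1
sz d = 2

-- L(v) is represented (up to relabelling) by Fin (sz v); V(H) is the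
-- disjoint union Σ V Col, partitioned by the lists.
Col : V → Set
Col v = Fin (sz v)

-- A correspondence cover of R with the given list sizes.
-- E u v x y = true  iff  x ∈ L(u) and y ∈ L(v) are adjacent in H.
record Cover : Set where
  field
    E        : (u v : V) → Col u → Col v → Bool
    E-sym    : ∀ u v (x : Col u) (y : Col v) → E u v x y ≡ E v u y x
    indep    : ∀ v (x y : Col v) → E v v x y ≡ false
    nonEdge  : ∀ u v (x : Col u) (y : Col v) → adjR u v ≡ false → E u v x y ≡ false
    -- edges between L(u) and L(v) form a matching (with E-sym this covers both sides)
    matching : ∀ u v (x : Col u) (y y' : Col v) →
               E u v x y ≡ true → E u v x y' ≡ true → y ≡ y'
open Cover public

Edge : Cover → (u v : V) → Col u → Col v → Set
Edge H u v x y = E H u v x y ≡ true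

AllMaximal : Cover → Set
AllMaximal H = ∀ u v → adjR u v ≡ true → ∀ (x : Col u) (y : Col v) →
  (Σ (Col v) λ y' → Edge H u v x y') ⊎ (Σ (Col u) λ x' → Edge H u v x' y)

Colouring : Set
Colouring = (v : V) → Col v

b2n : Bool → ℕ
b2n true  = 1
b2n false = 0

defect : (H : Cover) → Colouring → V → ℕ
defect H φ w = cnt a + cnt b + cnt c + cnt d
  where
  cnt : V → ℕ
  cnt w' = b2n (adjR w w' ∧ E H w' w (φ w') (φ w))

OneDefective : Cover → Colouring → Set
OneDefective H φ = ∀ w → defect H φ w ≤ 1

other : Fin 2 → Fin 2
other zero = suc zero
other (suc _) = zero

a₁ : Col a
a₁ = zero

c₁ : Col c
c₁ = zero

-- Twisted: labelling b₁ = i, b₂ = other i, d₁ = j, d₂ = other j such that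
-- a₁ b₁ d₂ c₁ b₂ d₁ a₁ is a cycle in H.
Twisted : Cover → Set
Twisted H = Σ (Fin 2) λ i → Σ (Fin 2) λ j →
  Edge H a b a₁ i × Edge H b d i (other j) × Edge H d c (other j) c₁ ×
  Edge H c b c₁ (other i) × Edge H b d (other i) j × Edge H d a j a₁

AtLeastTwo : Set → Set → Set → Set
AtLeastTwo P Q S = (P × Q) ⊎ (P × S) ⊎ (Q × S)

Wedged : Cover → Set
Wedged H = Σ (Fin 2) λ i → Σ (Fin 2) λ j →
  Edge H a b a₁ i × Edge H a d a₁ j ×
  AtLeastTwo (Edge H b d (other i) (other j))
             (Edge H c b c₁ (other i))
             (Edge H c d c₁ (other j))

-- Label the colours as in the paper: b₁, d₁ are the partners of a₁, and b₂, d₂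
-- the other colours. Colouring b by b₂ and d by d₂ gives def(a) = 0, and the
-- conflicting edges of R are among b₂d₂, c₁b₂, c₁d₂; it is 1-defective exactly
-- when at most one of them is an edge of H, i.e. when the cover is not wedged
-- with this labelling. If two of them are edges, recolouring b by b₁ (or d by
-- d₁) confines the conflicts to the matching {ab, cd} (or {ad, cb}) of R; the
-- one remaining danger, the edge b₁d₂ when c₁b₂ and c₁d₂ are both edges, forces
-- b₂d₁ as well (a maximal matching of K₂,₂ is perfect) and hence a twist.
module Submission where

open import Data.Bool using (Bool; true; false)
open import Data.Bool.Properties using (¬-not)
open import Data.Empty using (⊥-elim)
open import Data.Fin using (Fin; zero; suc)
open import Data.Nat using (ℕ; suc; _+_; _≤_; z≤n)
open import Data.Nat.Properties using (≤-refl; +-identityʳ; +-monoˡ-≤)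
open import Data.Product using (Σ; _×_; _,_; proj₁; proj₂)
open import Data.Sum using (_⊎_; inj₁; inj₂)
open import Function using (_∘_)
open import Relation.Nullary using (¬_)
open import Relation.Binary.PropositionalEquality
  using (_≡_; _≢_; refl; sym; trans; cong; cong₂; subst)

open import Defs

other-≢ : (x : Fin 2) → other x ≢ x
other-≢ zero ()
other-≢ (suc zero) ()

≢-other : (x : Fin 2) → x ≢ other x
≢-other x = other-≢ x ∘ sym

≢⇒either : {x y : Fin 2} → x ≢ y → (z : Fin 2) → z ≡ x ⊎ z ≡ y
≢⇒either {zero}     {zero}     x≢y _          = ⊥-elim (x≢y refl)
≢⇒either {suc zero} {suc zero} x≢y _          = ⊥-elim (x≢y refl)
≢⇒either {zero}     {suc zero} _   zero       = inj₁ refl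
≢⇒either {zero}     {suc zero} _   (suc zero) = inj₂ refl
≢⇒either {suc zero} {zero}     _   zero       = inj₂ refl
≢⇒either {suc zero} {zero}     _   (suc zero) = inj₁ refl

twoTrue⊎twoFalse : ∀ p q r →
  AtLeastTwo (p ≡ true) (q ≡ true) (r ≡ true) ⊎
  AtLeastTwo (p ≡ false) (q ≡ false) (r ≡ false)
twoTrue⊎twoFalse true  true  _     = inj₁ (inj₁ (refl , refl))
twoTrue⊎twoFalse true  false true  = inj₁ (inj₂ (inj₁ (refl , refl)))
twoTrue⊎twoFalse true  false false = inj₂ (inj₂ (inj₂ (refl , refl)))
twoTrue⊎twoFalse false true  true  = inj₁ (inj₂ (inj₂ (refl , refl)))
twoTrue⊎twoFalse false true  false = inj₂ (inj₂ (inj₁ (refl , refl)))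
twoTrue⊎twoFalse false false _     = inj₂ (inj₁ (refl , refl))

b2n≤1 : ∀ p → b2n p ≤ 1
b2n≤1 true  = ≤-refl
b2n≤1 false = z≤n

b2n-sum₂≤1 : ∀ {p q} → p ≡ false ⊎ q ≡ false → b2n p + b2n q ≤ 1
b2n-sum₂≤1 {q = q} (inj₁ refl) = b2n≤1 q
b2n-sum₂≤1 {p}     (inj₂ refl) = +-monoˡ-≤ 0 (b2n≤1 p)

b2n-sum₃≤1 : ∀ {p q r} → AtLeastTwo (p ≡ false) (q ≡ false) (r ≡ false) →
  b2n p + b2n q + b2n r ≤ 1
b2n-sum₃≤1 {r = r} (inj₁ (refl , refl))        = b2n≤1 r
b2n-sum₃≤1 {q = q} (inj₂ (inj₁ (refl , refl))) = +-monoˡ-≤ 0 (b2n≤1 q)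
b2n-sum₃≤1 {p}     (inj₂ (inj₂ (refl , refl))) = +-monoˡ-≤ 0 (b2n-sum₂≤1 {p} (inj₂ refl))

record IsMatching {m n : ℕ} (R : Fin m → Fin n → Bool) : Set where
  field
    functional : ∀ {x y y'} → R x y ≡ true → R x y' ≡ true → y ≡ y'
    injective  : ∀ {x x' y} → R x y ≡ true → R x' y ≡ true → x ≡ x'

IsMaximal : {m n : ℕ} → (Fin m → Fin n → Bool) → Set
IsMaximal {m} {n} R = ∀ x y → (Σ (Fin n) λ y' → R x y' ≡ true) ⊎ (Σ (Fin m) λ x' → R x' y ≡ true)

module _ {m n : ℕ} {R : Fin m → Fin n → Bool} (M : IsMatching R) where
  open IsMatching M

  unmatchedʳ : ∀ {x y y'} → R x y ≡ true → y' ≢ y → R x y' ≡ false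
  unmatchedʳ xy y'≢y = ¬-not λ xy' → y'≢y (functional xy' xy)

  unmatchedˡ : ∀ {x x' y} → R x y ≡ true → x' ≢ x → R x' y ≡ false
  unmatchedˡ xy x'≢x = ¬-not λ x'y → x'≢x (injective x'y xy)

partner : {n : ℕ} {R : Fin 1 → Fin (suc n) → Bool} → IsMaximal R →
  Σ (Fin (suc n)) λ y → R zero y ≡ true
partner maximal with maximal zero zero
... | inj₁ matched  = matched
... | inj₂ (zero , e) = zero , e

opposite-edge : {R : Fin 2 → Fin 2 → Bool} → IsMatching R → IsMaximal R →
  ∀ {x y x' y'} → R x y ≡ true → x' ≢ x → y' ≢ y → R x' y' ≡ true
opposite-edge M maximal {x} {y} {x'} {y'} xy x'≢x y'≢y with maximal x' y'
... | inj₁ (z , x'z) with ≢⇒either y'≢y z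
...   | inj₁ refl = x'z
...   | inj₂ refl = ⊥-elim (x'≢x (IsMatching.injective M x'z xy))
opposite-edge M maximal {x} {y} {x'} {y'} xy x'≢x y'≢y
    | inj₂ (z , zy') with ≢⇒either x'≢x z
...   | inj₁ refl = zy'
...   | inj₂ refl = ⊥-elim (y'≢y (IsMatching.functional M zy' xy))

edge-sym : (H : Cover) → ∀ {u v x y} → Edge H u v x y → Edge H v u y x
edge-sym H {u} {v} {x} {y} e = trans (E-sym H v u y x) e

isMatching : (H : Cover) → ∀ u v → IsMatching (E H u v)
isMatching H u v = record
  { functional = matching H u v _ _ _
  ; injective  = λ e e' → matching H v u _ _ _ (edge-sym H e) (edge-sym H e')
  }

colouring : Col b → Col d → Colouring
colouring i j a = a₁
colouring i j b = i
colouring i j c = c₁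
colouring i j d = j

module Conflicts (H : Cover) (i : Col b) (j : Col d) where
  ab ad cb cd bd : Bool
  ab = E H a b a₁ i
  ad = E H a d a₁ j
  cb = E H c b c₁ i
  cd = E H c d c₁ j
  bd = E H b d i j

  load : V → ℕ
  load a = b2n ab + b2n ad
  load b = b2n ab + b2n cb + b2n bd
  load c = b2n cb + b2n cd
  load d = b2n ad + b2n bd + b2n cd

  defect≡load : ∀ w → defect H (colouring i j) w ≡ load w
  defect≡load a = cong₂ _+_ (trans (+-identityʳ _) (cong b2n (E-sym H b a i a₁)))
                            (cong b2n (E-sym H d a j a₁))
  defect≡load b = cong₂ _+_ (cong (_+ b2n cb) (+-identityʳ _)) (cong b2n (E-sym H d b j i))
  defect≡load c = cong₂ _+_ (trans (+-identityʳ _) (cong b2n (E-sym H b c i c₁)))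
                            (cong b2n (E-sym H d c j c₁))
  defect≡load d = +-identityʳ _

  -- The three maximal matchings of R.
  data ConflictsInMatching : Set where
    ⊆ab+cd : ad ≡ false → cb ≡ false → bd ≡ false → ConflictsInMatching
    ⊆ad+cb : ab ≡ false → cd ≡ false → bd ≡ false → ConflictsInMatching
    ⊆bd    : ab ≡ false → ad ≡ false → cb ≡ false → cd ≡ false → ConflictsInMatching

  load≤1 : ConflictsInMatching → ∀ w → load w ≤ 1
  load≤1 (⊆ab+cd no-ad no-cb no-bd) a = b2n-sum₂≤1 (inj₂ no-ad)
  load≤1 (⊆ab+cd no-ad no-cb no-bd) b = b2n-sum₃≤1 (inj₂ (inj₂ (no-cb , no-bd)))
  load≤1 (⊆ab+cd no-ad no-cb no-bd) c = b2n-sum₂≤1 (inj₁ no-cb)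
  load≤1 (⊆ab+cd no-ad no-cb no-bd) d = b2n-sum₃≤1 (inj₁ (no-ad , no-bd))
  load≤1 (⊆ad+cb no-ab no-cd no-bd) a = b2n-sum₂≤1 (inj₁ no-ab)
  load≤1 (⊆ad+cb no-ab no-cd no-bd) b = b2n-sum₃≤1 (inj₂ (inj₁ (no-ab , no-bd)))
  load≤1 (⊆ad+cb no-ab no-cd no-bd) c = b2n-sum₂≤1 (inj₂ no-cd)
  load≤1 (⊆ad+cb no-ab no-cd no-bd) d = b2n-sum₃≤1 (inj₂ (inj₂ (no-bd , no-cd)))
  load≤1 (⊆bd no-ab no-ad no-cb no-cd) a = b2n-sum₂≤1 (inj₁ no-ab)
  load≤1 (⊆bd no-ab no-ad no-cb no-cd) b = b2n-sum₃≤1 (inj₁ (no-ab , no-cb))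
  load≤1 (⊆bd no-ab no-ad no-cb no-cd) c = b2n-sum₂≤1 (inj₁ no-cb)
  load≤1 (⊆bd no-ab no-ad no-cb no-cd) d = b2n-sum₃≤1 (inj₂ (inj₁ (no-ad , no-cd)))

  oneDefective : ConflictsInMatching → OneDefective H (colouring i j)
  oneDefective κ w = subst (_≤ 1) (sym (defect≡load w)) (load≤1 κ w)

open Conflicts using (ConflictsInMatching; ⊆ab+cd; ⊆ad+cb; ⊆bd; oneDefective; defect≡load)

module Partners (H : Cover) (maximal : AllMaximal H) where
  b₁ : Col b
  b₁ = proj₁ (partner (maximal a b refl))

  a₁b₁ : Edge H a b a₁ b₁
  a₁b₁ = proj₂ (partner (maximal a b refl))

  d₁ : Col d
  d₁ = proj₁ (partner (maximal a d refl))

  a₁d₁ : Edge H a d a₁ d₁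
  a₁d₁ = proj₂ (partner (maximal a d refl))

  b₂ : Col b
  b₂ = other b₁

  d₂ : Col d
  d₂ = other d₁

  no-a₁b₂ : E H a b a₁ b₂ ≡ false
  no-a₁b₂ = unmatchedʳ (isMatching H a b) a₁b₁ (other-≢ b₁)

  no-a₁d₂ : E H a d a₁ d₂ ≡ false
  no-a₁d₂ = unmatchedʳ (isMatching H a d) a₁d₁ (other-≢ d₁)

  b₂d₂-colouring :
    AtLeastTwo (E H b d b₂ d₂ ≡ false) (E H c b c₁ b₂ ≡ false) (E H c d c₁ d₂ ≡ false) →
    OneDefective H (colouring b₂ d₂) × defect H (colouring b₂ d₂) a ≡ 0
  b₂d₂-colouring twoAbsent =
    oneDefective H b₂ d₂ (withinMatching twoAbsent) ,
    trans (defect≡load H b₂ d₂ a) (cong₂ (λ p q → b2n p + b2n q) no-a₁b₂ no-a₁d₂)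
    where
    withinMatching :
      AtLeastTwo (E H b d b₂ d₂ ≡ false) (E H c b c₁ b₂ ≡ false) (E H c d c₁ d₂ ≡ false) →
      ConflictsInMatching H b₂ d₂
    withinMatching (inj₁ (no-b₂d₂ , no-c₁b₂))        = ⊆ab+cd no-a₁d₂ no-c₁b₂ no-b₂d₂
    withinMatching (inj₂ (inj₁ (no-b₂d₂ , no-c₁d₂))) = ⊆ad+cb no-a₁b₂ no-c₁d₂ no-b₂d₂
    withinMatching (inj₂ (inj₂ (no-c₁b₂ , no-c₁d₂))) = ⊆bd no-a₁b₂ no-a₁d₂ no-c₁b₂ no-c₁d₂

  wedge⊎avoid :
    AtLeastTwo (Edge H b d b₂ d₂) (Edge H c b c₁ b₂) (Edge H c d c₁ d₂) ⊎
    AtLeastTwo (E H b d b₂ d₂ ≡ false) (E H c b c₁ b₂ ≡ false) (E H c d c₁ d₂ ≡ false)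
  wedge⊎avoid = twoTrue⊎twoFalse (E H b d b₂ d₂) (E H c b c₁ b₂) (E H c d c₁ d₂)

  wedged-colouring : ¬ Twisted H →
    AtLeastTwo (Edge H b d b₂ d₂) (Edge H c b c₁ b₂) (Edge H c d c₁ d₂) →
    Σ Colouring (OneDefective H)
  wedged-colouring _ (inj₁ (b₂d₂ , c₁b₂)) =
    colouring b₁ d₂ , oneDefective H b₁ d₂
      (⊆ab+cd no-a₁d₂ (unmatchedʳ (isMatching H c b) c₁b₂ (≢-other b₁))
                      (unmatchedˡ (isMatching H b d) b₂d₂ (≢-other b₁)))
  wedged-colouring _ (inj₂ (inj₁ (b₂d₂ , c₁d₂))) =
    colouring b₂ d₁ , oneDefective H b₂ d₁
      (⊆ad+cb no-a₁b₂ (unmatchedʳ (isMatching H c d) c₁d₂ (≢-other d₁))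
                      (unmatchedʳ (isMatching H b d) b₂d₂ (≢-other d₁)))
  wedged-colouring ¬twisted (inj₂ (inj₂ (c₁b₂ , c₁d₂))) =
    colouring b₁ d₂ , oneDefective H b₁ d₂
      (⊆ab+cd no-a₁d₂ (unmatchedʳ (isMatching H c b) c₁b₂ (≢-other b₁)) no-b₁d₂)
    where
    no-b₁d₂ : E H b d b₁ d₂ ≡ false
    no-b₁d₂ = ¬-not λ b₁d₂ → ¬twisted
      ( b₁ , d₁ , a₁b₁ , b₁d₂ , edge-sym H c₁d₂ , c₁b₂
      , opposite-edge (isMatching H b d) (maximal b d refl) b₁d₂ (other-≢ b₁) (≢-other d₁)
      , edge-sym H a₁d₁ )

lemma5p2 : (H : Cover) → AllMaximal H → ¬ Twisted H →
    (Σ Colouring λ φ → OneDefective H φ) ×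
    (¬ Wedged H → Σ Colouring λ φ → OneDefective H φ × defect H φ a ≡ 0)
lemma5p2 H maximal ¬twisted = colourable , avoiding-a
  where
  open Partners H maximal

  colourable : Σ Colouring (OneDefective H)
  colourable with wedge⊎avoid
  ... | inj₁ wedge = wedged-colouring ¬twisted wedge
  ... | inj₂ avoid = colouring b₂ d₂ , proj₁ (b₂d₂-colouring avoid)

  avoiding-a : ¬ Wedged H → Σ Colouring λ φ → OneDefective H φ × defect H φ a ≡ 0
  avoiding-a ¬wedged with wedge⊎avoid
  ... | inj₁ wedge = ⊥-elim (¬wedged (b₁ , d₁ , a₁b₁ , a₁d₁ , wedge))
  ... | inj₂ avoid = colouring b₂ d₂ , b₂d₂-colouring avoid
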